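{- Let $u$ and $v$ be binary words with $u\trianglelefteq v$. Then $F(u)\trianglelefteq F(v)$.
   Context: For a binary word $w$ (over $\{0,1\}$), the flip $F(w)$ is the word obtained by reversing every occurrence of the factor $10$ in $w$ (i.e., replacing each contiguous $10$ by $01$; such occurrences never overlap). For binary words $u,v$, write $u\trianglelefteq v$ if for every $i$, the $i$th zero of $u$ (counting from the left), whenever it exists, occurs at the same position as or at an earlier position than the $i$th zero of $v$ (in particular $v$ has at least as many zeros as $u$). -}

module Defs where

open import Data.Nat using (ℕ; zero; suc; _≤_; _<_)
open import Data.List using (List; []; _∷_; length; lookup)
open import Data.Fin using (Fin; toℕ)
open import Data.Product using (Σ; _×_)
open import Relation.Binary.PropositionalEquality using (_≡_)

data Bit : Set where
  b0 b1 : Bit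

Word : Set
Word = List Bit

-- The flip F(w): replace every occurrence of the factor 10 by 01
-- (occurrences never overlap, so scanning left to right is correct).
flip : Word → Word
flip []            = []
flip (b1 ∷ b0 ∷ w) = b0 ∷ b1 ∷ flip w
flip (b ∷ w)       = b ∷ flip w

zerosFrom : ℕ → Word → List ℕ
zerosFrom k []       = []
zerosFrom k (b0 ∷ w) = k ∷ zerosFrom (suc k) w
zerosFrom k (b1 ∷ w) = zerosFrom (suc k) w

zeroPositions : Word → List ℕ
zeroPositions = zerosFrom 0

_⊴_ : Word → Word → Set
u ⊴ v = Σ (length (zeroPositions u) ≤ length (zeroPositions v)) λ len →
          (i : Fin (length (zeroPositions u))) (j : Fin (length (zeroPositions v))) →
          toℕ i ≡ toℕ j → lookup (zeroPositions u) i ≤ lookup (zeroPositions v) j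

-- If z₁ < z₂ < … are the zero positions of w, then the i-th zero of F(w)
-- sits at max(z_{i-1} + 1, z_i − 1) (with z₀ + 1 read as 0): each zero moves
-- one step left unless the letter before it is a zero or it starts the word.
-- This expression is monotone in z_{i-1} and z_i, and u ⊴ v says exactly
-- that the zero positions of u are pointwise below a prefix of those of v.
module Submission where

open import Defs
open import Data.Nat using (ℕ; suc; _≤_; _⊔_; _∸_; s≤s)
open import Data.Nat.Properties
  using (≤-refl; ≤-trans; n≤1+n; m∸n≤m; ⊔-mono-≤; ∸-monoˡ-≤; m≤n⇒m⊔n≡n; m≥n⇒m⊔n≡m; pred-mono-≤; suc-injective)
open import Data.List using (List; []; _∷_; length; lookup)
open import Data.List.Relation.Binary.Prefix.Heterogeneous using (Prefix; []; _∷_)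
open import Data.List.Relation.Binary.Prefix.Heterogeneous.Properties using (length-mono)
open import Data.Fin using (Fin; toℕ; zero; suc)
open import Data.Product using (_,_)
open import Relation.Binary.Core using (REL)
open import Relation.Binary.PropositionalEquality using (_≡_; refl; cong; cong₂; sym)

module _ {a b r} {A : Set a} {B : Set b} {R : REL A B r} where

  Prefix⇒lookup : ∀ {xs ys} → Prefix R xs ys →
    (i : Fin (length xs)) (j : Fin (length ys)) → toℕ i ≡ toℕ j → R (lookup xs i) (lookup ys j)
  Prefix⇒lookup (r ∷ rs) zero    zero    _  = r
  Prefix⇒lookup (r ∷ rs) (suc i) (suc j) eq = Prefix⇒lookup rs i j (suc-injective eq)

  lookup⇒Prefix : ∀ xs ys → length xs ≤ length ys →
    ((i : Fin (length xs)) (j : Fin (length ys)) → toℕ i ≡ toℕ j → R (lookup xs i) (lookup ys j)) →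
    Prefix R xs ys
  lookup⇒Prefix []       ys       _   _ = []
  lookup⇒Prefix (x ∷ xs) (y ∷ ys) len r =
    r zero zero refl ∷ lookup⇒Prefix xs ys (pred-mono-≤ len) (λ i j eq → r (suc i) (suc j) (cong suc eq))

⊴⇒Prefix : ∀ u v → u ⊴ v → Prefix _≤_ (zeroPositions u) (zeroPositions v)
⊴⇒Prefix u v (len , r) = lookup⇒Prefix (zeroPositions u) (zeroPositions v) len r

-- The first argument is one past the position of the previous zero.
flipZeros : ℕ → List ℕ → List ℕ
flipZeros m []       = []
flipZeros m (z ∷ zs) = m ⊔ (z ∸ 1) ∷ flipZeros (suc z) zs

flipZeros-mono : ∀ {m m′ zs zs′} → m ≤ m′ → Prefix _≤_ zs zs′ → Prefix _≤_ (flipZeros m zs) (flipZeros m′ zs′)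
flipZeros-mono m≤m′ []         = []
flipZeros-mono m≤m′ (z≤z′ ∷ p) = ⊔-mono-≤ m≤m′ (∸-monoˡ-≤ 1 z≤z′) ∷ flipZeros-mono (s≤s z≤z′) p

mutual
  zerosFrom-flip : ∀ k w → zerosFrom k (flip w) ≡ flipZeros k (zerosFrom k w)
  zerosFrom-flip k []       = refl
  zerosFrom-flip k (b0 ∷ w) = cong₂ _∷_ (sym (m≥n⇒m⊔n≡m (m∸n≤m k 1))) (zerosFrom-flip (suc k) w)
  zerosFrom-flip k (b1 ∷ w) = zerosFrom-flip-b1∷ k w ≤-refl

  -- A run of ones starting at k is flipped together with the zero ending it,
  -- which lands one step left, hence after every earlier zero.
  zerosFrom-flip-b1∷ : ∀ k w {m} → m ≤ k → zerosFrom k (flip (b1 ∷ w)) ≡ flipZeros m (zerosFrom (suc k) w)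
  zerosFrom-flip-b1∷ k []       m≤k = refl
  zerosFrom-flip-b1∷ k (b0 ∷ w) m≤k = cong₂ _∷_ (sym (m≤n⇒m⊔n≡n m≤k)) (zerosFrom-flip (suc (suc k)) w)
  zerosFrom-flip-b1∷ k (b1 ∷ w) m≤k = zerosFrom-flip-b1∷ (suc k) w (≤-trans m≤k (n≤1+n k))

proposition3p1 : (u v : Word) → u ⊴ v → flip u ⊴ flip v
proposition3p1 u v u⊴v rewrite zerosFrom-flip 0 u | zerosFrom-flip 0 v =
  length-mono flipped , Prefix⇒lookup flipped
  where
  flipped : Prefix _≤_ (flipZeros 0 (zeroPositions u)) (flipZeros 0 (zeroPositions v))
  flipped = flipZeros-mono ≤-refl (⊴⇒Prefix u v u⊴v)
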